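{- Every class of graphs that locally excludes minors is quasi-wide.
   Context: Graphs are finite, undirected, loopless, without parallel edges. $N_r^{\mathbf{G}}(v)$ is the set of vertices at distance at most $r$ from $v$. A class $\mathcal{C}$ of graphs locally excludes minors if there is $f:\mathbb{N}\to\mathbb{N}$ such that for every $\mathbf{G}\in\mathcal{C}$, every vertex $v$ of $\mathbf{G}$ and every $r$, the complete graph $\mathbf{K}_{f(r)}$ is not a minor of the subgraph induced by $N_r^{\mathbf{G}}(v)$. A vertex set $S$ in a graph $\mathbf{H}$ is $r$-scattered if $N_r^{\mathbf{H}}(a)\cap N_r^{\mathbf{H}}(b)=\emptyset$ for distinct $a,b\in S$. A class of graphs $\mathcal{C}$ is quasi-wide if there is $g:\mathbb{N}\to\mathbb{N}$ such that for all $r,m$ there is $N$ such that every $\mathbf{G}\in\mathcal{C}$ with at least $N$ vertices contains a set $B$ of at most $g(r)$ vertices such that $\mathbf{G}[V^{\mathbf{G}}\setminus B]$ contains an $r$-scattered set of size $m$. -}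

module Defs where

open import Data.Nat using (ℕ; zero; suc; _≤_)
open import Data.Fin using (Fin; _≟_)
open import Data.Fin.Subset using (Subset; _∈_; _∉_; _⊆_; ∁; ∣_∣)
open import Data.Product using (Σ; ∃; ∃-syntax; _×_; _,_)
open import Data.Unit using (⊤)
open import Relation.Nullary using (¬_; Dec; ¬?)
open import Relation.Binary.PropositionalEquality using (_≡_; _≢_; sym; refl)

record Graph : Set₁ where
  field
    n     : ℕ
    E     : Fin n → Fin n → Set
    E-sym : ∀ {u v} → E u v → E v u
    E-irr : ∀ {u} → ¬ E u u
    E-dec : ∀ u v → Dec (E u v)
open Graph public

V : Graph → Set
V G = Fin (n G)

K : ℕ → Graph
K k = record
  { n = k
  ; E = λ i j → i ≢ j
  ; E-sym = λ p q → p (sym q)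
  ; E-irr = λ p → p refl
  ; E-dec = λ i j → ¬? (i ≟ j)
  }

-- Walks of length at most r in the induced subgraph G[P]
-- (all vertices of the walk satisfy P).
data WalkIn (G : Graph) (P : V G → Set) : ℕ → V G → V G → Set where
  here : ∀ {r u} → P u → WalkIn G P r u u
  step : ∀ {r u w v} → P u → E G u w → WalkIn G P r w v → WalkIn G P (suc r) u v

InBall : (G : Graph) (P : V G → Set) → ℕ → V G → V G → Set
InBall G P r a x = WalkIn G P r a x

All : (G : Graph) → V G → Set
All G _ = ⊤

Connected : (G : Graph) (Q : V G → Set) → Set
Connected G Q = ∀ x y → Q x → Q y → ∃[ r ] WalkIn G Q r x y

IsMinorOf : (H G : Graph) (S : V G → Set) → Set
IsMinorOf H G S =
  Σ (V H → Subset (n G)) λ β →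
      (∀ i → ∃[ x ] x ∈ β i)
    × (∀ i j → i ≢ j → ∀ x → x ∈ β i → x ∉ β j)
    × (∀ i x → x ∈ β i → S x)
    × (∀ i → Connected G (λ x → x ∈ β i))
    × (∀ i j → E H i j → ∃[ x ] ∃[ y ] (x ∈ β i × y ∈ β j × E G x y))

GraphClass : Set₁
GraphClass = Graph → Set

LocallyExcludesMinors : GraphClass → Set₁
LocallyExcludesMinors C =
  Σ (ℕ → ℕ) λ f → (∀ (G : Graph) → C G → ∀ (v : V G) (r : ℕ) →
    ¬ IsMinorOf (K (f r)) G (InBall G (All G) r v))

Scattered : (G : Graph) (P : V G → Set) (r : ℕ) (S : Subset (n G)) → Set
Scattered G P r S =
  ∀ a b → a ∈ S → b ∈ S → a ≢ b → ∀ x → ¬ (InBall G P r a x × InBall G P r b x)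

QuasiWide : GraphClass → Set₁
QuasiWide C =
  Σ (ℕ → ℕ) λ g → ∀ (r m : ℕ) → Σ ℕ λ N → ∀ (G : Graph) → C G → N ≤ n G →
    Σ (Subset (n G)) λ B → (∣ B ∣ ≤ g r ×
      Σ (Subset (n G)) λ S → (∣ S ∣ ≡ m × S ⊆ ∁ B × Scattered G (λ x → x ∉ B) r S))

-- Blocking at most h = f (3d + 3) further vertices, a large d-scattered set of
-- centres in G − B can be thinned to m centres that are (d + 1)-scattered in the smaller graph;
-- r such rounds, starting from all vertices, give the theorem with g r = Σ_{d < r} f (3d + 3).
-- In a round the d-balls around the centres are disjoint.  By Ramsey's theorem either h of
-- these balls are pairwise adjacent, or many are pairwise non-adjacent; among those, either m
-- have disjoint (d + 1)-balls and we are done, or many have pairwise meeting (d + 1)-balls.  In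
-- the last case, if some unblocked vertex outside all balls is adjacent to many of them, block
-- it and continue with those balls; after h blockers, h balls each together with its own
-- blocker form a model of K_h.  Otherwise every such vertex touches few balls, and a greedy
-- choice of balls joined by such meeting vertices again yields a model of K_h.  Every model
-- built this way lies in the (3d + 3)-ball of a vertex, contradicting the choice of f.

module Submission where

open import Defs hiding (All)
open import Defs using () renaming (All to AllVertices)
open import Data.Nat using (ℕ; zero; suc; _+_; _*_; _≤_; _<_; z≤n; s≤s; _≤?_)
open import Data.Nat.Properties
  using (module ≤-Reasoning; ≤-refl; ≤-trans; ≤-reflexive; n≤1+n; m≤n+m; m≤m+n; +-comm; +-suc; +-assoc;
         +-identityʳ; +-monoˡ-≤; +-monoʳ-≤; +-cancelˡ-≤; ≰⇒≥; ≰⇒>; <⇒≤; ⊓-glb; m≤n⇒m⊓n≡m)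
open import Data.Empty using (⊥; ⊥-elim)
open import Data.Fin using (Fin; zero; suc; _≟_; inject≤)
open import Data.Fin.Properties using (any?; inject≤-injective)
open import Data.Fin.Subset using (Subset; inside; outside; ∣_∣; ∁)
  renaming (_∈_ to _∈ₛ_; _∉_ to _∉ₛ_; _⊆_ to _⊆ₛ_; ⊥ to ∅)
open import Data.Fin.Subset.Properties using (∣⊥∣≡0; x∉p⇒x∈∁p) renaming (_∈?_ to _∈ₛ?_; ∉⊥ to ∉∅)
open import Data.Vec using (_∷_; here; there; tabulate; _[_]≔_)
open import Data.Vec.Properties
  using (lookup∘tabulate; lookup⇒[]=; []=⇒lookup; []≔-updates; []≔-minimal; []≔-lookup; lookup∘updateAt′)
open import Data.List using (List; []; _∷_; length; filter; lookup; map; zip; _++_; take; allFin)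
open import Data.List.Membership.Propositional using (_∈_; _∉_)
import Data.List.Membership.DecPropositional as DecMembership
open import Data.List.Membership.Propositional.Properties using (∈-++⁺ˡ; ∈-++⁺ʳ; ∈-++⁻)
open import Data.List.Properties using (length-map; length-zipWith; length-++; length-take; length-tabulate)
open import Data.List.Relation.Unary.Any using (here; there)
open import Data.List.Relation.Unary.All using (All; []; _∷_)
import Data.List.Relation.Unary.All as All
open import Data.List.Relation.Unary.All.Properties using (all-filter)
import Data.List.Relation.Unary.All.Properties as All
import Data.List.Relation.Unary.AllPairs.Properties as AllPairs
open import Data.List.Relation.Unary.AllPairs using (AllPairs; []; _∷_)
import Data.List.Relation.Unary.AllPairs as AllPairs
open import Data.List.Relation.Binary.Sublist.Propositional
  using (_⊆_; []; _∷_; _∷ʳ_; minimum; ⊆-refl; ⊆-trans)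
open import Data.List.Relation.Binary.Sublist.Propositional.Properties
  using (∷ˡ⁻; take-⊆; filter-⊆; filter⁺; length-mono-≤; All-resp-⊆; Any-resp-⊆)
open import Data.Product using (Σ; ∃; ∃₂; _×_; _,_; proj₁; proj₂)
import Data.Product as Product
open import Data.Unit using (tt)
open import Data.Sum using (_⊎_; inj₁; inj₂)
open import Function using (_∘_)
open import Level using (_⊔_; 0ℓ)
open import Relation.Nullary using (¬_; ¬?; Dec; yes; no)
open import Relation.Nullary.Decidable using (does; dec-true; _×-dec_; _⊎-dec_)
open import Relation.Unary using (Pred; Decidable)
open import Relation.Unary.Properties using (∁?)
open import Relation.Binary using (Rel; Symmetric)
import Relation.Binary as Binary
open import Relation.Binary.PropositionalEquality using (_≡_; _≢_; refl; sym; trans; cong; subst)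

m+n≤o+p⇒m≤o⊎n≤p : ∀ m n o p → m + n ≤ o + p → m ≤ o ⊎ n ≤ p
m+n≤o+p⇒m≤o⊎n≤p m n o p m+n≤o+p with m ≤? o
... | yes m≤o = inj₁ m≤o
... | no m≰o = inj₂ (+-cancelˡ-≤ o n p (≤-trans (+-monoˡ-≤ n (≰⇒≥ m≰o)) m+n≤o+p))

length-filter-∁ : ∀ {a p} {A : Set a} {P : Pred A p} (P? : Decidable P) xs →
                  length (filter P? xs) + length (filter (∁? P?) xs) ≡ length xs
length-filter-∁ P? [] = refl
length-filter-∁ P? (x ∷ xs) with P? x
... | yes _ = cong suc (length-filter-∁ P? xs)
... | no _ = trans (+-suc _ _) (cong suc (length-filter-∁ P? xs))

lookup-All : ∀ {A : Set} {P : A → Set} {xs} → All P xs → ∀ i → P (lookup xs i)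
lookup-All (px ∷ _) zero = px
lookup-All (_ ∷ pxs) (suc i) = lookup-All pxs i

lookup-AllPairs : ∀ {A : Set} {R : Rel A 0ℓ} → Symmetric R → ∀ {xs} → AllPairs R xs →
                  ∀ i j → i ≢ j → R (lookup xs i) (lookup xs j)
lookup-AllPairs sym (_ ∷ _) zero zero 0≢0 = ⊥-elim (0≢0 refl)
lookup-AllPairs sym (Rx ∷ _) zero (suc j) _ = lookup-All Rx j
lookup-AllPairs sym (Rx ∷ _) (suc i) zero _ = sym (lookup-All Rx i)
lookup-AllPairs sym (_ ∷ Rxs) (suc i) (suc j) i≢j = lookup-AllPairs sym Rxs i j (i≢j ∘ cong suc)

module _ {A : Set} {R : Rel A 0ℓ} where

  AllPairs-resp-⊆ : ∀ {xs ys} → xs ⊆ ys → AllPairs R ys → AllPairs R xs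
  AllPairs-resp-⊆ [] [] = []
  AllPairs-resp-⊆ (_ ∷ʳ xs⊆ys) (_ ∷ Rys) = AllPairs-resp-⊆ xs⊆ys Rys
  AllPairs-resp-⊆ (refl ∷ xs⊆ys) (Ry ∷ Rys) = All-resp-⊆ xs⊆ys Ry ∷ AllPairs-resp-⊆ xs⊆ys Rys

  AllPairs-lookup : Symmetric R → ∀ {xs} → AllPairs R xs → ∀ {x y} → x ∈ xs → y ∈ xs → x ≢ y → R x y
  AllPairs-lookup sym (_ ∷ _) (here refl) (here refl) x≢y = ⊥-elim (x≢y refl)
  AllPairs-lookup sym (Rx ∷ _) (here refl) (there y∈) _ = All.lookup Rx y∈
  AllPairs-lookup sym (Rx ∷ _) (there x∈) (here refl) _ = sym (All.lookup Rx x∈)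
  AllPairs-lookup sym (_ ∷ Rxs) (there x∈) (there y∈) x≢y = AllPairs-lookup sym Rxs x∈ y∈ x≢y

All⇒AllPairs : ∀ {A : Set} {P : A → Set} {xs} → All P xs → AllPairs (λ x y → P x × P y) xs
All⇒AllPairs [] = []
All⇒AllPairs (px ∷ pxs) = All.map (px ,_) pxs ∷ All⇒AllPairs pxs

module _ {A B : Set} where

  zip-∈ : ∀ (xs : List A) (ys : List B) → All (λ p → proj₁ p ∈ xs × proj₂ p ∈ ys) (zip xs ys)
  zip-∈ (x ∷ xs) (y ∷ ys) = (here refl , here refl) ∷ All.map (Product.map there there) (zip-∈ xs ys)
  zip-∈ [] _ = []
  zip-∈ (_ ∷ _) [] = []

  zip-AllPairs : ∀ {R : Rel A 0ℓ} {S : Rel B 0ℓ} {xs ys} → AllPairs R xs → AllPairs S ys →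
                 AllPairs (λ p q → R (proj₁ p) (proj₁ q) × S (proj₂ p) (proj₂ q)) (zip xs ys)
  zip-AllPairs (Rx ∷ Rxs) (Sy ∷ Sys) = zip-All Rx Sy ∷ zip-AllPairs Rxs Sys
    where
      zip-All : ∀ {P Q xs ys} → All P xs → All Q ys → All (λ p → P (proj₁ p) × Q (proj₂ p)) (zip xs ys)
      zip-All (px ∷ pxs) (qy ∷ qys) = (px , qy) ∷ zip-All pxs qys
      zip-All [] _ = []
      zip-All (_ ∷ _) [] = []
  zip-AllPairs [] _ = []
  zip-AllPairs (_ ∷ _) [] = []

-- Ramsey's theorem

ramsey : ℕ → ℕ → ℕ
ramsey zero t = 0
ramsey (suc s) zero = 0
ramsey (suc s) (suc t) = suc (ramsey s (suc t) + ramsey (suc s) t)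

module _ {a ℓ} {A : Set a} (R : Rel A ℓ) where

  Homogeneous : ℕ → ℕ → List A → Set (a ⊔ ℓ)
  Homogeneous s t xs = ∃ λ ys → ys ⊆ xs ×
    ((s ≤ length ys × AllPairs R ys) ⊎ (t ≤ length ys × AllPairs (λ x y → ¬ R x y) ys))

  ∷-friends : ∀ {s t x xs ys} → ys ⊆ xs → All (R x) ys →
              Homogeneous s (suc t) ys → Homogeneous (suc s) (suc t) (x ∷ xs)
  ∷-friends {x = x} ys⊆xs Rx (zs , zs⊆ys , inj₁ (s≤ , clique)) =
    x ∷ zs , refl ∷ ⊆-trans zs⊆ys ys⊆xs , inj₁ (s≤s s≤ , All-resp-⊆ zs⊆ys Rx ∷ clique)
  ∷-friends {x = x} ys⊆xs Rx (zs , zs⊆ys , inj₂ anti) = zs , x ∷ʳ ⊆-trans zs⊆ys ys⊆xs , inj₂ anti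

  ∷-strangers : ∀ {s t x xs ys} → ys ⊆ xs → All (λ y → ¬ R x y) ys →
                Homogeneous (suc s) t ys → Homogeneous (suc s) (suc t) (x ∷ xs)
  ∷-strangers {x = x} ys⊆xs Rx (zs , zs⊆ys , inj₁ clique) = zs , x ∷ʳ ⊆-trans zs⊆ys ys⊆xs , inj₁ clique
  ∷-strangers {x = x} ys⊆xs Rx (zs , zs⊆ys , inj₂ (t≤ , anti)) =
    x ∷ zs , refl ∷ ⊆-trans zs⊆ys ys⊆xs , inj₂ (s≤s t≤ , All-resp-⊆ zs⊆ys Rx ∷ anti)

  ramsey-homogeneous : Binary.Decidable R → ∀ s t xs → ramsey s t ≤ length xs → Homogeneous s t xs
  ramsey-homogeneous R? zero t xs _ = [] , minimum xs , inj₁ (z≤n , [])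
  ramsey-homogeneous R? (suc s) zero xs _ = [] , minimum xs , inj₂ (z≤n , [])
  ramsey-homogeneous R? (suc s) (suc t) (x ∷ xs) (s≤s ≤xs)
    with m+n≤o+p⇒m≤o⊎n≤p _ _ _ _ (subst (_ ≤_) (sym (length-filter-∁ (R? x) xs)) ≤xs)
  ... | inj₁ ≤friends = ∷-friends (filter-⊆ (R? x) xs) (all-filter (R? x) xs)
                          (ramsey-homogeneous R? s (suc t) _ ≤friends)
  ... | inj₂ ≤strangers = ∷-strangers (filter-⊆ (∁? (R? x)) xs) (all-filter (∁? (R? x)) xs)
                            (ramsey-homogeneous R? (suc s) t _ ≤strangers)

module _ {n} {P : Fin n → Set} (P? : Decidable P) where

  toSubset : Subset n
  toSubset = tabulate (does ∘ P?)

  ∈-toSubset⁺ : ∀ {x} → P x → x ∈ₛ toSubset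
  ∈-toSubset⁺ {x} px = lookup⇒[]= x toSubset (trans (lookup∘tabulate _ x) (dec-true (P? x) px))

  ∈-toSubset⁻ : ∀ {x} → x ∈ₛ toSubset → P x
  ∈-toSubset⁻ {x} x∈ with P? x | trans (sym (lookup∘tabulate (does ∘ P?) x)) ([]=⇒lookup x∈)
  ... | yes px | _ = px
  ... | no _ | ()

∣p[x]≔inside∣≡1+∣p∣ : ∀ {n} (p : Subset n) x → x ∉ₛ p → ∣ p [ x ]≔ inside ∣ ≡ suc ∣ p ∣
∣p[x]≔inside∣≡1+∣p∣ (outside ∷ p) zero _ = refl
∣p[x]≔inside∣≡1+∣p∣ (inside ∷ p) zero x∉p = ⊥-elim (x∉p here)
∣p[x]≔inside∣≡1+∣p∣ (outside ∷ p) (suc x) x∉p = ∣p[x]≔inside∣≡1+∣p∣ p x (x∉p ∘ there)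
∣p[x]≔inside∣≡1+∣p∣ (inside ∷ p) (suc x) x∉p = cong suc (∣p[x]≔inside∣≡1+∣p∣ p x (x∉p ∘ there))

x∈p⇒p[x]≔inside≡p : ∀ {n} (p : Subset n) x → x ∈ₛ p → p [ x ]≔ inside ≡ p
x∈p⇒p[x]≔inside≡p p x x∈p = subst (λ b → p [ x ]≔ b ≡ p) ([]=⇒lookup x∈p) ([]≔-lookup p x)

∣p[x]≔inside∣≤1+∣p∣ : ∀ {n} (p : Subset n) x → ∣ p [ x ]≔ inside ∣ ≤ suc ∣ p ∣
∣p[x]≔inside∣≤1+∣p∣ p x with x ∈ₛ? p
... | yes x∈p = ≤-trans (≤-reflexive (cong ∣_∣ (x∈p⇒p[x]≔inside≡p p x x∈p))) (n≤1+n _)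
... | no x∉p = ≤-reflexive (∣p[x]≔inside∣≡1+∣p∣ p x x∉p)

x∈p[y]≔inside⇒x≡y⊎x∈p : ∀ {n} (p : Subset n) {x} y → x ∈ₛ p [ y ]≔ inside → x ≡ y ⊎ x ∈ₛ p
x∈p[y]≔inside⇒x≡y⊎x∈p p {x} y x∈ with x ≟ y
... | yes x≡y = inj₁ x≡y
... | no x≢y = inj₂ (lookup⇒[]= x p (trans (sym (lookup∘updateAt′ x y x≢y p)) ([]=⇒lookup x∈)))

fromList : ∀ {n} → List (Fin n) → Subset n
fromList [] = ∅
fromList (x ∷ xs) = fromList xs [ x ]≔ inside

∈-fromList⁺ : ∀ {n} {x : Fin n} {xs} → x ∈ xs → x ∈ₛ fromList xs
∈-fromList⁺ {xs = y ∷ xs} (here refl) = []≔-updates (fromList xs) y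
∈-fromList⁺ {x = x} {y ∷ xs} (there x∈xs) with x ≟ y
... | yes refl = []≔-updates (fromList xs) y
... | no x≢y = []≔-minimal (fromList xs) x y x≢y (∈-fromList⁺ x∈xs)

∈-fromList⁻ : ∀ {n} {x : Fin n} {xs} → x ∈ₛ fromList xs → x ∈ xs
∈-fromList⁻ {xs = []} x∈ = ⊥-elim (∉∅ x∈)
∈-fromList⁻ {xs = y ∷ xs} x∈ with x∈p[y]≔inside⇒x≡y⊎x∈p (fromList xs) y x∈
... | inj₁ x≡y = here x≡y
... | inj₂ x∈xs = there (∈-fromList⁻ x∈xs)

∣fromList∣≤length : ∀ {n} (xs : List (Fin n)) → ∣ fromList xs ∣ ≤ length xs
∣fromList∣≤length {n} [] = ≤-reflexive (∣⊥∣≡0 n)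
∣fromList∣≤length (x ∷ xs) = ≤-trans (∣p[x]≔inside∣≤1+∣p∣ (fromList xs) x) (s≤s (∣fromList∣≤length xs))

∣fromList∣≡length : ∀ {n} {xs : List (Fin n)} → AllPairs _≢_ xs → ∣ fromList xs ∣ ≡ length xs
∣fromList∣≡length {n} [] = ∣⊥∣≡0 n
∣fromList∣≡length {xs = x ∷ xs} (x∉xs ∷ distinct) =
  trans (∣p[x]≔inside∣≡1+∣p∣ (fromList xs) x (λ x∈ → All.lookup x∉xs (∈-fromList⁻ x∈) refl))
        (cong suc (∣fromList∣≡length distinct))

-- Walks

module _ {G : Graph} where

  walk-map : ∀ {P Q : V G → Set} {r u v} → (∀ x → P x → Q x) → WalkIn G P r u v → WalkIn G Q r u v
  walk-map P⇒Q (here p) = here (P⇒Q _ p)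
  walk-map P⇒Q (step p e w) = step (P⇒Q _ p) e (walk-map P⇒Q w)

  module _ {P : V G → Set} where

    walk-≤ : ∀ {r s u v} → r ≤ s → WalkIn G P r u v → WalkIn G P s u v
    walk-≤ _ (here p) = here p
    walk-≤ (s≤s r≤s) (step p e w) = step p e (walk-≤ r≤s w)

    walk-head : ∀ {r u v} → WalkIn G P r u v → P u
    walk-head (here p) = p
    walk-head (step p _ _) = p

    infixr 5 _++ʷ_
    _++ʷ_ : ∀ {r s u v w} → WalkIn G P r u v → WalkIn G P s v w → WalkIn G P (r + s) u w
    _++ʷ_ {r} {s} (here _) w = walk-≤ (m≤n+m s r) w
    step p e w ++ʷ w′ = step p e (w ++ʷ w′)

    walk-reverse : ∀ {r u v} → WalkIn G P r u v → WalkIn G P r v u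
    walk-reverse (here p) = here p
    walk-reverse {suc r} (step p e w) =
      walk-≤ (≤-reflexive (+-comm r 1)) (walk-reverse w ++ʷ step (walk-head w) (E-sym G e) (here p))

    walk-unsnoc : ∀ {r u v} → WalkIn G P (suc r) u v →
                  WalkIn G P r u v ⊎ ∃ λ y → WalkIn G P r u y × E G y v × P v
    walk-unsnoc (here p) = inj₁ (here p)
    walk-unsnoc {zero} (step p e (here q)) = inj₂ (_ , here p , e , q)
    walk-unsnoc {suc r} (step p e w) with walk-unsnoc w
    ... | inj₁ w′ = inj₁ (step p e w′)
    ... | inj₂ (y , w′ , e′ , q) = inj₂ (y , step p e w′ , e′ , q)

    walk-inward : ∀ {r u v} → WalkIn G P r u v → WalkIn G (λ y → WalkIn G P r y v) r u v
    walk-inward (here p) = here (here p)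
    walk-inward w@(step _ e w′) = step w e (walk-map (λ _ → walk-≤ (n≤1+n _)) (walk-inward w′))

    walk? : Decidable P → ∀ r u v → Dec (WalkIn G P r u v)
    walk? P? r u v with P? u | u ≟ v
    ... | no ¬p | _ = no λ w → ¬p (walk-head w)
    ... | yes p | yes refl = yes (here p)
    walk? P? zero u v | yes p | no u≢v = no λ { (here _) → u≢v refl }
    walk? P? (suc r) u v | yes p | no u≢v with any? (λ w → E-dec G u w ×-dec walk? P? r w v)
    ... | yes (w , e , w′) = yes (step p e w′)
    ... | no ¬step = no λ { (here _) → u≢v refl ; (step _ e w′) → ¬step (_ , e , w′) }

walk-forget : ∀ {G P r u v} → WalkIn G P r u v → WalkIn G (AllVertices G) r u v
walk-forget = walk-map (λ _ _ → tt)

-- Complete minors from lists of branch sets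

module _ (G : Graph) {I : Set} (β : I → V G → Set) where

  Adjoining : Rel I 0ℓ
  Adjoining i j = (∀ x → β i x → ¬ β j x) × ∃₂ λ x y → β i x × β j y × E G x y

  adjoining-sym : Symmetric Adjoining
  adjoining-sym (disjoint , x , y , x∈i , y∈j , e) =
    (λ z z∈j z∈i → disjoint z z∈i z∈j) , y , x , y∈j , x∈i , E-sym G e

module _ {G : Graph} {S : V G → Set} where

  K-minor-≤ : ∀ {h k} → h ≤ k → IsMinorOf (K k) G S → IsMinorOf (K h) G S
  K-minor-≤ {h} {k} h≤k (β , nonempty , disjoint , within , connected , adjacent) =
      β ∘ ι , nonempty ∘ ι , (λ i j → disjoint (ι i) (ι j) ∘ ι-≢) , within ∘ ι , connected ∘ ι
    , λ i j → adjacent (ι i) (ι j) ∘ ι-≢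
    where
      ι : Fin h → Fin k
      ι i = inject≤ i h≤k
      ι-≢ : ∀ {i j} → i ≢ j → ι i ≢ ι j
      ι-≢ {i} {j} i≢j = i≢j ∘ inject≤-injective h≤k h≤k i j

  module _ {I : Set} (β : I → V G → Set) (β? : ∀ i → Decidable (β i)) where

    IsBranchSet : I → Set
    IsBranchSet i = ∃ (β i) × (∀ x → β i x → S x) × Connected G (β i)

    complete-minor : (is : List I) → All IsBranchSet is → AllPairs (Adjoining G β) is →
                     IsMinorOf (K (length is)) G S
    complete-minor is branch adjoining =
        B
      , (λ i → let x , x∈ = proj₁ (branch′ i) in x , in⁺ i x∈)
      , (λ i j i≢j x x∈i x∈j → proj₁ (adjoining′ i j i≢j) x (in⁻ i x∈i) (in⁻ j x∈j))
      , (λ i x x∈ → proj₁ (proj₂ (branch′ i)) x (in⁻ i x∈))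
      , (λ i x y x∈ y∈ → Product.map₂ (walk-map (λ _ → in⁺ i))
                                       (proj₂ (proj₂ (branch′ i)) x y (in⁻ i x∈) (in⁻ i y∈)))
      , λ i j i≢j → let x , y , x∈ , y∈ , e = proj₂ (adjoining′ i j i≢j) in x , y , in⁺ i x∈ , in⁺ j y∈ , e
      where
        at : Fin (length is) → I
        at = lookup is
        B : Fin (length is) → Subset (n G)
        B i = toSubset (β? (at i))
        in⁺ : ∀ i {x} → β (at i) x → x ∈ₛ B i
        in⁺ i = ∈-toSubset⁺ (β? (at i))
        in⁻ : ∀ i {x} → x ∈ₛ B i → β (at i) x
        in⁻ i = ∈-toSubset⁻ (β? (at i))
        branch′ : ∀ i → IsBranchSet (at i)
        branch′ = lookup-All branch
        adjoining′ : ∀ i j → i ≢ j → Adjoining G β (at i) (at j)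
        adjoining′ = lookup-AllPairs (adjoining-sym G β) adjoining

-- Scattered lists and one round of thinning

module _ (G : Graph) where

  open DecMembership (_≟_ {n G}) using (_∉?_)

  avoids? : ∀ B → Decidable (_∉ B)
  avoids? B x = x ∉? B

  Separated : List (V G) → ℕ → Rel (V G) 0ℓ
  Separated B r a b = ∀ x → ¬ (WalkIn G (_∉ B) r a x × WalkIn G (_∉ B) r b x)

  ScatteredList : List (V G) → ℕ → List (V G) → Set
  ScatteredList B r as = All (_∉ B) as × AllPairs (Separated B r) as

  separated-sym : ∀ {B r} → Symmetric (Separated B r)
  separated-sym sep x (wb , wa) = sep x (wa , wb)

  scattered-⊆ : ∀ {B r xs ys} → xs ⊆ ys → ScatteredList B r ys → ScatteredList B r xs
  scattered-⊆ xs⊆ys (avoid , sep) = All-resp-⊆ xs⊆ys avoid , AllPairs-resp-⊆ xs⊆ys sep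

  scattered⇒distinct : ∀ {B r as} → ScatteredList B r as → AllPairs _≢_ as
  scattered⇒distinct {as = []} _ = []
  scattered⇒distinct {as = a ∷ as} (a∉B ∷ avoid , sep-a ∷ sep) =
    All.map (λ { sep-ab refl → sep-ab a (here a∉B , here a∉B) }) sep-a ∷ scattered⇒distinct (avoid , sep)

greedy-size : ℕ → ℕ → ℕ → ℕ
greedy-size T zero k = 0
greedy-size T (suc g) k = suc (k * T + greedy-size T g (suc k))

-- Centres needed for a round, with j blockers still to choose; the outer suc only makes the
-- list nonempty, so that it supplies a root for the contradicting minor.
level-size : ℕ → ℕ → ℕ → ℕ
level-size h m zero = suc h
level-size h m (suc j) = suc (ramsey h (ramsey (suc (greedy-size (level-size h m j) h 0)) m))

record ScatteredSet (G : Graph) (b m r : ℕ) : Set where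
  field
    blockers : List (V G)
    centres : List (V G)
    blockers-count : length blockers ≤ b
    centres-count : m ≤ length centres
    scattered : ScatteredList G blockers r centres

NoLocalMinor : Graph → (ℕ → ℕ) → Set
NoLocalMinor G f = ∀ v r → ¬ IsMinorOf (K (f r)) G (InBall G (AllVertices G) r v)

reach : ℕ → ℕ
reach d = suc (suc (d + d))

-- A blob has its centre within reach d of the root and its vertices within d + 1 of the centre.
radius : ℕ → ℕ
radius d = reach d + suc d

module Round (G : Graph) (f : ℕ → ℕ) (no-minor : NoLocalMinor G f) (d : ℕ) (B₀ : List (V G)) where

  open DecMembership (_≟_ {n G}) using (_∈?_)

  h : ℕ
  h = f (radius d)

  Ball : V G → V G → Set
  Ball a = WalkIn G (_∉ B₀) d a

  ball? : ∀ a → Decidable (Ball a)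
  ball? a = walk? (avoids? G B₀) d a

  Touches : V G → V G → Set
  Touches w a = ∃ λ y → Ball a y × E G w y

  touches? : ∀ w → Decidable (Touches w)
  touches? w a = any? λ y → ball? a y ×-dec E-dec G w y

  BallsAdjacent : Rel (V G) 0ℓ
  BallsAdjacent a b = ∃₂ λ x y → Ball a x × Ball b y × E G x y

  ballsAdjacent? : Binary.Decidable BallsAdjacent
  ballsAdjacent? a b = any? λ x → any? λ y → ball? a x ×-dec ball? b y ×-dec E-dec G x y

  Attached : V G → V G → Set
  Attached a b = Touches b a × ¬ Ball a b

  Near : V G → V G → Set
  Near = WalkIn G (AllVertices G) (reach d)

  near-adjacent : ∀ {a b} → BallsAdjacent a b → Near a b
  near-adjacent (x , y , wx , wy , e) =
    walk-≤ (≤-trans (≤-reflexive (+-suc d d)) (n≤1+n _))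
      (walk-forget wx ++ʷ step tt e (walk-reverse (walk-forget wy)))

  near-common : ∀ {c a b} → Touches c a → Touches c b → Near a b
  near-common (x , wx , e) (y , wy , e′) =
    walk-≤ (≤-reflexive (trans (+-suc d (suc d)) (cong suc (+-suc d d))))
      (walk-forget wx ++ʷ step tt (E-sym G e) (step tt e′ (walk-reverse (walk-forget wy))))

  Blob : Set
  Blob = V G × List (V G)

  blob : Blob → V G → Set
  blob (a , W) x = Ball a x ⊎ x ∈ W

  blob? : ∀ b → Decidable (blob b)
  blob? (a , W) x = ball? a x ⊎-dec (x ∈? W)

  Rooted : V G → Blob → Set
  Rooted v (a , W) = a ∉ B₀ × Near v a × All (λ w → Touches w a) W

  blob-within : ∀ {v a W} → Near v a → All (λ w → Touches w a) W → ∀ x → blob (a , W) x →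
                InBall G (AllVertices G) (radius d) v x
  blob-within near _ x (inj₁ wx) = walk-≤ (+-monoʳ-≤ (reach d) (n≤1+n d)) (near ++ʷ walk-forget wx)
  blob-within near touch x (inj₂ x∈W) =
    let y , wy , e = All.lookup touch x∈W in
    walk-≤ (≤-reflexive (cong (reach d +_) (+-comm d 1)))
      (near ++ʷ walk-forget wy ++ʷ step tt (E-sym G e) (here tt))

  blob-connected : ∀ {a W} → All (λ w → Touches w a) W → Connected G (blob (a , W))
  blob-connected {a} {W} touch x y x∈ y∈ =
    let r , wx = to-centre x x∈ ; s , wy = to-centre y y∈ in r + s , wx ++ʷ walk-reverse wy
    where
      to-centre : ∀ x → blob (a , W) x → ∃ λ r → WalkIn G (blob (a , W)) r x a
      to-centre x (inj₁ wx) = d , walk-map (λ _ w → inj₁ (walk-reverse w)) (walk-inward (walk-reverse wx))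
      to-centre x (inj₂ x∈W) with All.lookup touch x∈W
      ... | y , wy , e = Product.map suc (step (inj₂ x∈W) e) (to-centre y (inj₁ wy))

  rooted-branch-set : ∀ {v b} → Rooted v b → IsBranchSet {S = InBall G (AllVertices G) (radius d) v} blob blob? b
  rooted-branch-set (a∉B₀ , near , touch) =
    (_ , inj₁ (here a∉B₀)) , blob-within near touch , blob-connected touch

  no-blob-clique : ∀ v bs → h ≤ length bs → All (Rooted v) bs → AllPairs (Adjoining G blob) bs → ⊥
  no-blob-clique v bs h≤ rooted adjoining =
    no-minor v (radius d)
      (K-minor-≤ h≤ (complete-minor blob blob? bs (All.map rooted-branch-set rooted) adjoining))

  bare : V G → Blob
  bare a = a , []

  bare-adjoining : ∀ {a b} → Separated G B₀ d a b → BallsAdjacent a b → Adjoining G blob (bare a) (bare b)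
  bare-adjoining sep (x , y , wx , wy , e) =
      (λ { z (inj₁ wa) (inj₁ wb) → sep z (wa , wb) ; _ (inj₁ _) (inj₂ ()) ; _ (inj₂ ()) _ })
    , x , y , inj₁ wx , inj₁ wy , e

  -- The vertex serves as root only for the empty model, when cs = [] and so h = 0.
  no-adjacent-clique : V G → ∀ cs → ScatteredList G B₀ d cs → h ≤ length cs → AllPairs BallsAdjacent cs → ⊥
  no-adjacent-clique v [] _ h≤ _ = no-blob-clique v [] h≤ [] []
  no-adjacent-clique _ (c ∷ cs) (avoid , sep) h≤ adjacent@(c-adjacent ∷ _) =
    no-blob-clique c (map bare (c ∷ cs)) (subst (h ≤_) (sym (length-map bare (c ∷ cs))) h≤)
      (All.map⁺ (All.zipWith (λ (a∉B₀ , near) → a∉B₀ , near , [])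
                             (avoid , here tt ∷ All.map near-adjacent c-adjacent)))
      (AllPairs.map⁺ (AllPairs.zipWith (Product.uncurry bare-adjoining) (sep , adjacent)))

  crown-blob : V G × V G → Blob
  crown-blob (a , b) = a , b ∷ []

  crown-adjoining : ∀ {a a′ b b′} → Separated G B₀ d a a′ → b ≢ b′ → Attached a b′ → Attached a′ b →
                    Adjoining G blob (crown-blob (a , b)) (crown-blob (a′ , b′))
  crown-adjoining sep b≢b′ (_ , b′∉a) ((y , wy , e) , b∉a′) =
      (λ { x (inj₁ wa) (inj₁ wa′) → sep x (wa , wa′)
         ; x (inj₁ wa) (inj₂ (here refl)) → b′∉a wa
         ; x (inj₂ (here refl)) (inj₁ wa′) → b∉a′ wa′
         ; x (inj₂ (here refl)) (inj₂ (here x≡b′)) → b≢b′ x≡b′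
         ; _ (inj₂ (there ())) _
         ; _ (inj₂ (here _)) (inj₂ (there ())) })
    , _ , y , inj₂ (here refl) , inj₁ wy , e

  no-crown : ∀ {a as bs} → ScatteredList G B₀ d (a ∷ as) → AllPairs _≢_ bs →
             h ≤ length (a ∷ as) → h ≤ length bs → All (λ a → All (Attached a) bs) (a ∷ as) → ⊥
  no-crown {a} {as} {bs} (avoid , sep) distinct h≤as h≤bs attached =
    no-blob-clique a (map crown-blob pairs) h≤blobs
      (All.map⁺ (All.map rooted (zip-∈ (a ∷ as) bs)))
      (AllPairs.map⁺ (AllPairs.zipWith adjoining
        (All⇒AllPairs (zip-∈ (a ∷ as) bs) , zip-AllPairs sep distinct)))
    where
      pairs : List (V G × V G)
      pairs = zip (a ∷ as) bs

      attached′ : ∀ {a′ b} → a′ ∈ a ∷ as → b ∈ bs → Attached a′ b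
      attached′ a′∈ b∈ = All.lookup (All.lookup attached a′∈) b∈

      h≤blobs : h ≤ length (map crown-blob pairs)
      h≤blobs = subst (h ≤_) (sym (trans (length-map crown-blob pairs) (length-zipWith _,_ (a ∷ as) bs)))
                      (⊓-glb h≤as h≤bs)

      rooted : ∀ {p} → proj₁ p ∈ a ∷ as × proj₂ p ∈ bs → Rooted a (crown-blob p)
      rooted (a′∈ , b∈) =
        All.lookup avoid a′∈ , near-common (proj₁ (attached′ (here refl) b∈)) (proj₁ (attached′ a′∈ b∈)) ,
        proj₁ (attached′ a′∈ b∈) ∷ []

      adjoining : ∀ {p q} → ((proj₁ p ∈ a ∷ as × proj₂ p ∈ bs) × (proj₁ q ∈ a ∷ as × proj₂ q ∈ bs)) ×
                  (Separated G B₀ d (proj₁ p) (proj₁ q) × proj₂ p ≢ proj₂ q) →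
                  Adjoining G blob (crown-blob p) (crown-blob q)
      adjoining (((a′∈ , b∈) , (a″∈ , b′∈)) , (sep , b≢b′)) =
        crown-adjoining sep b≢b′ (attached′ a′∈ b′∈) (attached′ a″∈ b∈)

  Close : List (V G) → Rel (V G) 0ℓ
  Close bs a b = ∃ λ x → WalkIn G (_∉ bs ++ B₀) (suc d) a x × WalkIn G (_∉ bs ++ B₀) (suc d) b x

  close? : ∀ bs → Binary.Decidable (Close bs)
  close? bs a b = any? λ x → walk? (avoids? G (bs ++ B₀)) (suc d) a x ×-dec
                              walk? (avoids? G (bs ++ B₀)) (suc d) b x

  close-sym : ∀ {bs} → Symmetric (Close bs)
  close-sym (x , wa , wb) = x , wb , wa

  NonAdjacent : Rel (V G) 0ℓ
  NonAdjacent a b = ¬ BallsAdjacent a b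

  nonAdjacent-sym : Symmetric NonAdjacent
  nonAdjacent-sym ¬adj (x , y , wx , wy , e) = ¬adj (y , x , wy , wx , E-sym G e)

  Good : List (V G) → List (V G) → V G → Set
  Good bs qs c = c ∉ bs ++ B₀ × All (λ e → ¬ Ball e c) qs

  good? : ∀ bs qs → Decidable (Good bs qs)
  good? bs qs c = avoids? G (bs ++ B₀) c ×-dec All.all? (λ e → ¬? (ball? e c)) qs

  module Greedy (bs qs : List (V G)) (scattered : ScatteredList G B₀ d qs)
                (nonadjacent : AllPairs NonAdjacent qs) (close : AllPairs (Close bs) qs) where

    private
      unblock : ∀ {r a x} → WalkIn G (_∉ bs ++ B₀) r a x → WalkIn G (_∉ B₀) r a x
      unblock = walk-map (λ _ x∉ x∈ → x∉ (∈-++⁺ʳ bs x∈))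

      nonadjacent′ : ∀ {a b} → a ∈ qs → b ∈ qs → a ≢ b → NonAdjacent a b
      nonadjacent′ = AllPairs-lookup nonAdjacent-sym nonadjacent

    connector : ∀ {a b} → a ∈ qs → b ∈ qs → a ≢ b → ∃ λ c → Good bs qs c × Touches c a × Touches c b
    connector {a} {b} a∈ b∈ a≢b with AllPairs-lookup close-sym close a∈ b∈ a≢b
    ... | x , wa , wb with walk-unsnoc wa | walk-unsnoc wb
    ... | inj₁ wa′ | inj₁ wb′ =
          ⊥-elim (AllPairs-lookup (separated-sym G) (proj₂ scattered) a∈ b∈ a≢b x (unblock wa′ , unblock wb′))
    ... | inj₁ wa′ | inj₂ (yb , wyb , eb , _) =
          ⊥-elim (nonadjacent′ a∈ b∈ a≢b (x , yb , unblock wa′ , unblock wyb , E-sym G eb))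
    ... | inj₂ (ya , wya , ea , _) | inj₁ wb′ =
          ⊥-elim (nonadjacent′ a∈ b∈ a≢b (ya , x , unblock wya , unblock wb′ , ea))
    ... | inj₂ (ya , wya , ea , x∉) | inj₂ (yb , wyb , eb , _) =
          x , (x∉ , All.tabulate off-balls) , (ya , unblock wya , E-sym G ea) , (yb , unblock wyb , E-sym G eb)
      where
        off-balls : ∀ {e} → e ∈ qs → ¬ Ball e x
        off-balls {e} e∈ we with e ≟ a
        ... | yes refl = nonadjacent′ a∈ b∈ a≢b (x , yb , we , unblock wyb , E-sym G eb)
        ... | no e≢a = nonadjacent′ e∈ a∈ e≢a (x , ya , we , unblock wya , E-sym G ea)

    GoodNeighbour : V G → V G → Set
    GoodNeighbour a w = Touches w a × Good bs qs w

    Entry : Blob → Set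
    Entry (a , W) = a ∈ qs × All (GoodNeighbour a) W

    Compatible : V G → Blob → Set
    Compatible p (a , W) = p ≢ a × All (λ w → ¬ Touches w p) W

    Reached : List (V G) → Blob → Set
    Reached W (a , _) = ∃ λ w → w ∈ W × Touches w a

    connectors : ∀ {p} → p ∈ qs → ∀ ms → All Entry ms → All (Compatible p) ms →
                 ∃ λ W → length W ≡ length ms × All (GoodNeighbour p) W × All (Reached W) ms
    connectors p∈ [] [] [] = [] , refl , [] , []
    connectors p∈ ((a , _) ∷ ms) ((a∈ , _) ∷ entries) ((p≢a , _) ∷ compatible)
      with connectors p∈ ms entries compatible | connector p∈ a∈ p≢a
    ... | W , |W| , good , reached | c , c-good , touch-p , touch-a =
      c ∷ W , cong suc |W| , (touch-p , c-good) ∷ good ,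
      (c , here refl , touch-a) ∷ All.map (λ (w , w∈ , touch) → w , there w∈ , touch) reached

    new-adjoining : ∀ {p W b} → p ∈ qs → All (GoodNeighbour p) W → Entry b → Compatible p b → Reached W b →
                    Adjoining G blob (p , W) b
    new-adjoining {p} {W} {a , W₀} p∈ good (a∈ , good₀) (p≢a , untouched) (w , w∈ , y , wy , e) =
        (λ { x (inj₁ wp) (inj₁ wa) → AllPairs-lookup (separated-sym G) (proj₂ scattered) p∈ a∈ p≢a x (wp , wa)
           ; x (inj₁ wp) (inj₂ x∈W₀) → All.lookup (proj₂ (proj₂ (All.lookup good₀ x∈W₀))) p∈ wp
           ; x (inj₂ x∈W) (inj₁ wa) → All.lookup (proj₂ (proj₂ (All.lookup good x∈W))) a∈ wa
           ; x (inj₂ x∈W) (inj₂ x∈W₀) → All.lookup untouched x∈W₀ (proj₁ (All.lookup good x∈W)) })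
      , w , y , inj₂ w∈ , inj₁ wy , e

    prune : List (V G) → List (V G) → List (V G)
    prune [] P = P
    prune (w ∷ W) P = filter (∁? (touches? w)) (prune W P)

    prune-⊆ : ∀ W P → prune W P ⊆ P
    prune-⊆ [] P = ⊆-refl
    prune-⊆ (w ∷ W) P = ⊆-trans (filter-⊆ _ (prune W P)) (prune-⊆ W P)

    prune-untouched : ∀ W P → All (λ q → All (λ w → ¬ Touches w q) W) (prune W P)
    prune-untouched [] P = All.tabulate (λ _ → [])
    prune-untouched (w ∷ W) P =
      All.zipWith (λ (¬touch , untouched) → ¬touch ∷ untouched)
        (all-filter (∁? (touches? w)) (prune W P) , All-resp-⊆ (filter-⊆ _ _) (prune-untouched W P))

    module _ (T : ℕ) (few-touches : ∀ z → Good bs qs z → length (filter (touches? z) qs) < T) where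

      prune-length : ∀ W P → All (Good bs qs) W → P ⊆ qs → length P ≤ length W * T + length (prune W P)
      prune-length [] P _ _ = ≤-refl
      prune-length (w ∷ W) P (w-good ∷ good) P⊆qs = begin
        length P                                       ≤⟨ prune-length W P good P⊆qs ⟩
        length W * T + length P₁                       ≡⟨ cong (length W * T +_) (sym (length-filter-∁ (touches? w) P₁)) ⟩
        length W * T + (length touched + length P₂)    ≤⟨ +-monoʳ-≤ (length W * T) (+-monoˡ-≤ (length P₂) touched≤T) ⟩
        length W * T + (T + length P₂)                 ≡⟨ sym (+-assoc (length W * T) T (length P₂)) ⟩
        length W * T + T + length P₂                   ≡⟨ cong (_+ length P₂) (+-comm (length W * T) T) ⟩
        T + length W * T + length P₂                   ∎
        where
          open ≤-Reasoning
          P₁ = prune W P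
          P₂ = prune (w ∷ W) P
          touched : List (V G)
          touched = filter (touches? w) P₁
          touched≤T : length touched ≤ T
          touched≤T = <⇒≤ (≤-trans (s≤s (length-mono-≤ (filter⁺ (touches? w) (touches? w) (λ { refl t → t })
                                                                 (⊆-trans (prune-⊆ W P) P⊆qs))))
                                   (few-touches w w-good))

      -- k blobs built so far and the pool P of centres still available.  A new blob is the ball of
      -- a centre from the pool plus one connector to each earlier blob; each connector touches
      -- fewer than T balls, and the centres it touches are pruned from the pool.
      record Partial (k : ℕ) (P : List (V G)) : Set where
        field
          blobs : List Blob
          count : length blobs ≡ k
          entries : All Entry blobs
          adjoining : AllPairs (Adjoining G blob) blobs
          compatible : All (λ p → All (Compatible p) blobs) P

      extend : ∀ {k p P} → p ∷ P ⊆ qs → Partial k (p ∷ P) →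
               ∃ λ P′ → length P ≤ k * T + length P′ × P′ ⊆ P × Partial (suc k) P′
      extend {p = p} {P} pP⊆qs record { blobs = ms ; count = refl ; entries = entries
                                     ; adjoining = adjoining ; compatible = compat-p ∷ compat } =
        let W , |W| , good , reached = connectors p∈ ms entries compat-p in
        prune W P ,
        subst (λ i → length P ≤ i * T + length (prune W P)) |W| (prune-length W P (All.map proj₂ good) P⊆qs) ,
        prune-⊆ W P , record
          { blobs = (p , W) ∷ ms
          ; count = refl
          ; entries = (p∈ , good) ∷ entries
          ; adjoining = All.zipWith (λ (entry , compat , reach) → new-adjoining p∈ good entry compat reach)
                                    (entries , All.zip (compat-p , reached)) ∷ adjoining
          ; compatible = All.zipWith (λ ((q≢p , untouched) , compat-q) → (q≢p , untouched) ∷ compat-q)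
                                     (All.zip (All-resp-⊆ (prune-⊆ W P) P≢p , prune-untouched W P) ,
                                      All-resp-⊆ (prune-⊆ W P) compat)
          }
        where
          p∈ : p ∈ qs
          p∈ = Any-resp-⊆ pP⊆qs (here refl)
          P⊆qs : P ⊆ qs
          P⊆qs = ∷ˡ⁻ pP⊆qs
          P≢p : All (_≢ p) P
          P≢p = All.map (λ p≢q q≡p → p≢q (sym q≡p))
                        (AllPairs.head (AllPairs-resp-⊆ pP⊆qs (scattered⇒distinct G scattered)))

      greedy : ∀ g {k P} → P ⊆ qs → Partial k P → greedy-size T g k ≤ length P → ∃ (Partial (g + k))
      greedy zero _ π _ = _ , π
      greedy (suc g) {k} {p ∷ P} pP⊆qs π (s≤s size≤) =
        let P′ , bound , P′⊆P , π′ = extend pP⊆qs π in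
        subst (λ i → ∃ (Partial i)) (+-suc g k)
          (greedy g (⊆-trans P′⊆P (∷ˡ⁻ pP⊆qs)) π′ (+-cancelˡ-≤ (k * T) _ _ (≤-trans size≤ bound)))

      empty-partial : Partial 0 qs
      empty-partial = record
        { blobs = [] ; count = refl ; entries = [] ; adjoining = [] ; compatible = All.tabulate (λ _ → []) }

      module _ {v} (v∈ : v ∈ qs) where

        near-root : ∀ {a} → a ∈ qs → Near v a
        near-root {a} a∈ with v ≟ a
        ... | yes refl = here tt
        ... | no v≢a = let _ , _ , touch-v , touch-a = connector v∈ a∈ v≢a in near-common touch-v touch-a

        entry-rooted : ∀ {b} → Entry b → Rooted v b
        entry-rooted (a∈ , good) = All.lookup (proj₁ scattered) a∈ , near-root a∈ , All.map proj₁ good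

        greedy-impossible : greedy-size T h 0 ≤ length qs → ⊥
        greedy-impossible size≤ with greedy h ⊆-refl empty-partial size≤
        ... | _ , record { blobs = ms ; count = |ms| ; entries = entries ; adjoining = adjoining } =
          no-blob-clique v ms (≤-reflexive (sym (trans |ms| (+-identityʳ h))))
            (All.map entry-rooted entries) adjoining

  -- State of the blocker search: bs are the blockers chosen so far and j more may still be chosen.
  LevelClaim : ℕ → ℕ → Set
  LevelClaim m j = ∀ {bs as} → length bs + j ≡ h → AllPairs _≢_ bs → ScatteredList G B₀ d as →
                   All (λ a → All (Attached a) bs) as → level-size h m j ≤ length as →
                   ScatteredSet G (h + length B₀) m (suc d)

  private
    blockers-bound : ∀ {j} bs → length bs + j ≡ h → length (bs ++ B₀) ≤ h + length B₀
    blockers-bound {j} bs |bs| =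
      ≤-trans (≤-reflexive (length-++ bs))
        (+-monoˡ-≤ (length B₀) (≤-trans (m≤m+n (length bs) j) (≤-reflexive |bs|)))

  separated-centres : ∀ {m j bs zs} → length bs + j ≡ h → ScatteredList G B₀ d zs →
                      All (λ a → All (Attached a) bs) zs → m ≤ length zs → AllPairs (λ a b → ¬ Close bs a b) zs →
                      ScatteredSet G (h + length B₀) m (suc d)
  separated-centres {bs = bs} {zs} |bs| (avoid , _) attached m≤ far = record
    { blockers = bs ++ B₀
    ; centres = zs
    ; blockers-count = blockers-bound bs |bs|
    ; centres-count = m≤
    ; scattered = All.zipWith unblocked (avoid , attached) , AllPairs.map (λ ¬close x walks → ¬close (x , walks)) far
    }
    where
      unblocked : ∀ {a} → a ∉ B₀ × All (Attached a) bs → a ∉ bs ++ B₀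
      unblocked (a∉B₀ , attached-a) a∈ with ∈-++⁻ bs a∈
      ... | inj₁ a∈bs = proj₂ (All.lookup attached-a a∈bs) (here a∉B₀)
      ... | inj₂ a∈B₀ = a∉B₀ a∈B₀

  new-blocker : ∀ {m j bs qs} → LevelClaim m j → length bs + suc j ≡ h → AllPairs _≢_ bs →
                ScatteredList G B₀ d qs → All (λ a → All (Attached a) bs) qs →
                AllPairs NonAdjacent qs → AllPairs (Close bs) qs →
                suc (greedy-size (level-size h m j) h 0) ≤ length qs → ScatteredSet G (h + length B₀) m (suc d)
  new-blocker {qs = []} _ _ _ _ _ _ _ ()
  new-blocker {m} {j} {bs} {qs@(v ∷ _)} recurse |bs| distinct scattered attached nonadjacent close (s≤s size≤)
    with any? (λ z → good? bs qs z ×-dec (level-size h m j ≤? length (filter (touches? z) qs)))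
  ... | yes (z , (z∉ , off-balls) , many) =
        recurse (trans (sym (+-suc (length bs) j)) |bs|) (All.tabulate z≢ ∷ distinct)
          (scattered-⊆ G (filter-⊆ (touches? z) qs) scattered) attached′ many
    where
      z≢ : ∀ {b} → b ∈ bs → z ≢ b
      z≢ b∈ refl = z∉ (∈-++⁺ˡ b∈)
      attached′ : All (λ a → All (Attached a) (z ∷ bs)) (filter (touches? z) qs)
      attached′ = All.zipWith (λ (touch , off , old) → (touch , off) ∷ old)
                    (all-filter (touches? z) qs ,
                     All.zip (All-resp-⊆ (filter-⊆ (touches? z) qs) off-balls ,
                              All-resp-⊆ (filter-⊆ (touches? z) qs) attached))
  ... | no none =
        ⊥-elim (Greedy.greedy-impossible bs qs scattered nonadjacent close (level-size h m j) few (here refl)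
                  (≤-trans size≤ (n≤1+n _)))
    where
      few : ∀ z → Good bs qs z → length (filter (touches? z) qs) < level-size h m j
      few z good with level-size h m j ≤? length (filter (touches? z) qs)
      ... | yes many = ⊥-elim (none (z , good , many))
      ... | no ¬many = ≰⇒> ¬many

  level : ∀ m j → LevelClaim m j
  level m zero {as = []} _ _ _ _ ()
  level m zero {as = a ∷ as} |bs| distinct scattered attached (s≤s size≤) =
    ⊥-elim (no-crown scattered distinct (≤-trans size≤ (n≤1+n _))
                     (≤-reflexive (sym (trans (sym (+-identityʳ _)) |bs|))) attached)
  level m (suc j) {as = []} _ _ _ _ ()
  level m (suc j) {bs} {a ∷ as} |bs| distinct scattered attached (s≤s size≤)
    with ramsey-homogeneous BallsAdjacent ballsAdjacent? h _ (a ∷ as) (≤-trans size≤ (n≤1+n _))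
  ... | ys , ys⊆ , inj₁ (h≤ , adjacent) = ⊥-elim (no-adjacent-clique a ys (scattered-⊆ G ys⊆ scattered) h≤ adjacent)
  ... | ys , ys⊆ , inj₂ (≤ys , nonadjacent) with ramsey-homogeneous (Close bs) (close? bs) _ m ys ≤ys
  ...   | zs , zs⊆ , inj₂ (m≤ , far) =
          separated-centres |bs| (scattered-⊆ G (⊆-trans zs⊆ ys⊆) scattered)
            (All-resp-⊆ (⊆-trans zs⊆ ys⊆) attached) m≤ far
  ...   | qs , qs⊆ , inj₁ (≤qs , close) =
          new-blocker (level m j) |bs| distinct (scattered-⊆ G (⊆-trans qs⊆ ys⊆) scattered)
            (All-resp-⊆ (⊆-trans qs⊆ ys⊆) attached) (AllPairs-resp-⊆ qs⊆ nonadjacent) close ≤qs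

  refine : ∀ {m as} → ScatteredList G B₀ d as → level-size h m h ≤ length as →
           ScatteredSet G (h + length B₀) m (suc d)
  refine scattered size≤ = level _ h refl [] scattered (All.tabulate (λ _ → [])) size≤

-- Iterating the rounds

blocker-budget : (ℕ → ℕ) → ℕ → ℕ → ℕ
blocker-budget f zero d = 0
blocker-budget f (suc k) d = blocker-budget f k (suc d) + f (radius d)

initial-size : (ℕ → ℕ) → ℕ → ℕ → ℕ → ℕ
initial-size f m zero d = m
initial-size f m (suc k) d = level-size (f (radius d)) (initial-size f m k (suc d)) (f (radius d))

relax : ∀ {G b b′ m r} → b ≤ b′ → ScatteredSet G b m r → ScatteredSet G b′ m r
relax b≤b′ S = record
  { blockers = blockers ; centres = centres ; blockers-count = ≤-trans blockers-count b≤b′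
  ; centres-count = centres-count ; scattered = scattered }
  where open ScatteredSet S

all-vertices : ∀ G {N} → N ≤ n G → ScatteredSet G 0 N 0
all-vertices G N≤ = record
  { blockers = []
  ; centres = allFin (n G)
  ; blockers-count = z≤n
  ; centres-count = subst (_ ≤_) (sym (length-tabulate (λ x → x))) N≤
  ; scattered = All.tabulate (λ _ ()) , AllPairs.tabulate⁺ (λ { i≢j _ (here _ , here _) → i≢j refl })
  }

module _ {G f} (no-minor : NoLocalMinor G f) (m : ℕ) where

  iterate : ∀ k {b d} → ScatteredSet G b (initial-size f m k d) d →
            ScatteredSet G (blocker-budget f k d + b) m (k + d)
  iterate zero S = S
  iterate (suc k) {b} {d} S =
    subst (ScatteredSet G _ m) (+-suc k d)
      (relax (≤-reflexive (sym (+-assoc (blocker-budget f k (suc d)) (f (radius d)) b)))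
        (iterate k (relax (+-monoʳ-≤ (f (radius d)) blockers-count)
                     (Round.refine G f no-minor d blockers scattered centres-count))))
    where open ScatteredSet S

scattered-subsets : ∀ {G b m r} → ScatteredSet G b m r →
                    Σ (Subset (n G)) λ B → ∣ B ∣ ≤ b × Σ (Subset (n G)) λ S →
                      ∣ S ∣ ≡ m × S ⊆ₛ ∁ B × Scattered G (λ x → x ∉ₛ B) r S
scattered-subsets {G} {m = m} {r} record { blockers = bs ; centres = cs ; blockers-count = |bs|
                                         ; centres-count = m≤ ; scattered = avoid , separated } =
    fromList bs , ≤-trans (∣fromList∣≤length bs) |bs|
  , fromList ss
  , trans (∣fromList∣≡length (scattered⇒distinct G ss-scattered)) (trans (length-take m cs) (m≤n⇒m⊓n≡m m≤))
  , (λ x∈ → x∉p⇒x∈∁p (λ x∈bs → All.lookup (proj₁ ss-scattered) (∈-fromList⁻ x∈) (∈-fromList⁻ x∈bs)))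
  , λ a b a∈ b∈ a≢b x (wa , wb) →
      AllPairs-lookup (separated-sym G) (proj₂ ss-scattered) (∈-fromList⁻ a∈) (∈-fromList⁻ b∈) a≢b x
        (walk-map (λ _ → _∘ ∈-fromList⁺) wa , walk-map (λ _ → _∘ ∈-fromList⁺) wb)
  where
    ss : List (V G)
    ss = take m cs
    ss-scattered : ScatteredList G bs r ss
    ss-scattered = scattered-⊆ G (take-⊆ m cs) (avoid , separated)

mainTheorem7 : (C : GraphClass) → LocallyExcludesMinors C → QuasiWide C
mainTheorem7 C (f , excludes) =
  (λ r → blocker-budget f r 0) , λ r m → initial-size f m r 0 , λ G G∈C N≤ →
  scattered-subsets (subst (ScatteredSet G _ m) (+-identityʳ r)
    (relax (≤-reflexive (+-identityʳ _)) (iterate (excludes G G∈C) m r (all-vertices G N≤))))
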